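{- Let $X=\mathbb{N}\times\mathbb{N}$ (with $\mathbb{N}$ including $0$), and for $U\subseteq X$ and $i\in\mathbb{N}$ let $X_i=\{(i,j): j\in\mathbb{N}\}$ and $U_i=U\cap X_i$. Call $U\subseteq X$ distinguished if there is a finite set $I\subseteq\mathbb{N}$ such that $U_i$ is finite for every $i\in I$ and $U_i$ is cofinite relative to $X_i$ for every $i\notin I$; call $U$ codistinguished if its complement $X\setminus U$ is distinguished. Then the collection of all subsets of $X$ that are distinguished or codistinguished, with the operations $\cap$, $\cup$ and set complement, is a Boolean subalgebra of the Boolean algebra of all subsets of $X$. -}

module Defs where

open import Data.Nat using (ℕ)
open import Data.Bool using (Bool; true; false; not; _∧_; _∨_)
open import Data.Product using (_×_; _,_; ∃)
open import Data.Sum using (_⊎_)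
open import Data.List using (List)
open import Data.List.Membership.Propositional using (_∈_)
open import Relation.Binary.PropositionalEquality using (_≡_)
open import Relation.Nullary using (¬_)

-- X = ℕ × ℕ ; a subset of X is given by its (classical) characteristic function.
Subset : Set
Subset = ℕ × ℕ → Bool

∅ : Subset
∅ _ = false

full : Subset
full _ = true

_∩_ : Subset → Subset → Subset
(U ∩ V) x = U x ∧ V x

_∪_ : Subset → Subset → Subset
(U ∪ V) x = U x ∨ V x

∁ : Subset → Subset
∁ U x = not (U x)

FiniteRow : Subset → ℕ → Set
FiniteRow U i = ∃ λ (L : List ℕ) → ∀ j → U (i , j) ≡ true → j ∈ L

CofiniteRow : Subset → ℕ → Set
CofiniteRow U i = FiniteRow (∁ U) i

Distinguished : Subset → Set
Distinguished U = ∃ λ (I : List ℕ) →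
  (∀ i → i ∈ I → FiniteRow U i) × (∀ i → ¬ (i ∈ I) → CofiniteRow U i)

Codistinguished : Subset → Set
Codistinguished U = Distinguished (∁ U)

DistOrCodist : Subset → Set
DistOrCodist U = Distinguished U ⊎ Codistinguished U

record IsBooleanSubalgebra (P : Subset → Set) : Set where
  field
    has-∅    : P ∅
    has-full : P full
    closed-∩ : ∀ U V → P U → P V → P (U ∩ V)
    closed-∪ : ∀ U V → P U → P V → P (U ∪ V)
    closed-∁ : ∀ U → P U → P (∁ U)

module Submission where

-- Call a row X_i of a set U *finite* if U_i is finite and
-- *cofinite* if X_i ∖ U_i is finite.  A set U is called *tame of kind k*
-- (k ∈ {finite, cofinite}) when every row of U carries a kind together with
-- a proof of it, and only finitely many rows have a kind other than k.
--
--   * Row level: finite/cofinite rows are preserved by ∩, ∪ and ∁, with the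
--     kind of the result computed by a table (finite ∩ anything is finite,
--     cofinite ∩ cofinite is cofinite, dually for ∪; ∁ swaps the kinds).
--   * Set level: since only finitely many rows of each argument deviate from
--     its default kind, the same holds for U ∩ V and U ∪ V (the exceptional
--     rows are among the union of the two exception lists), and ∁ swaps the
--     default kind.  So tameness is preserved by the three operations.
--   * Distinguished sets are exactly the tame sets of kind cofinite and
--     codistinguished sets the tame sets of kind finite; the theorem follows
--     by translating back and forth.

open import Defs
open import Data.Nat using (ℕ)
open import Data.Nat.Properties using (_≟_)
open import Data.Bool using (true; false; not; _∧_; _∨_)
open import Data.Bool.Properties
  using (∧-conicalˡ; ∧-conicalʳ; not-involutive; ∨-∧-booleanAlgebra)
open import Algebra.Lattice.Properties.BooleanAlgebra ∨-∧-booleanAlgebra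
  using (deMorgan₁; deMorgan₂)
open import Data.Product using (_,_; ∃; proj₂)
open import Data.Sum using (_⊎_; inj₁; inj₂; [_,_])
open import Data.List using (List; []; _++_; filter)
open import Data.List.Membership.Propositional using (_∈_; _∉_)
open import Data.List.Membership.DecPropositional _≟_ using (_∈?_)
open import Data.List.Membership.Propositional.Properties
  using (∈-++⁺ˡ; ∈-++⁺ʳ; ∈-filter⁺; ∈-filter⁻)
open import Data.Empty using (⊥-elim)
open import Relation.Binary.PropositionalEquality
  using (_≡_; _≢_; refl; sym; trans; cong; subst)
open import Relation.Nullary using (yes; no)
open import Relation.Nullary.Decidable using (Dec)

∨-split : ∀ a b → a ∨ b ≡ true → a ≡ true ⊎ b ≡ true
∨-split true  _ _ = inj₁ refl
∨-split false _ p = inj₂ p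

not-∧-split : ∀ a b → not (a ∧ b) ≡ true → not a ≡ true ⊎ not b ≡ true
not-∧-split a b p = ∨-split (not a) (not b) (trans (sym (deMorgan₁ a b)) p)

not-∨ˡ : ∀ a b → not (a ∨ b) ≡ true → not a ≡ true
not-∨ˡ a b p = ∧-conicalˡ (not a) (not b) (trans (sym (deMorgan₂ a b)) p)

not-∨ʳ : ∀ a b → not (a ∨ b) ≡ true → not b ≡ true
not-∨ʳ a b p = ∧-conicalʳ (not a) (not b) (trans (sym (deMorgan₂ a b)) p)

finite-⊆ : ∀ {W U : Subset} {i} →
           (∀ j → W (i , j) ≡ true → U (i , j) ≡ true) →
           FiniteRow U i → FiniteRow W i
finite-⊆ W⊆U (L , U⊆L) = L , λ j w → U⊆L j (W⊆U j w)

finite-∪ : ∀ {W U V : Subset} {i} →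
           (∀ j → W (i , j) ≡ true → U (i , j) ≡ true ⊎ V (i , j) ≡ true) →
           FiniteRow U i → FiniteRow V i → FiniteRow W i
finite-∪ W⊆U∪V (L₁ , U⊆L₁) (L₂ , V⊆L₂) =
  L₁ ++ L₂ , λ j w → [ (λ u → ∈-++⁺ˡ (U⊆L₁ j u)) , (λ v → ∈-++⁺ʳ L₁ (V⊆L₂ j v)) ]
                       (W⊆U∪V j w)

data Kind : Set where
  fin cof : Kind

RowOf : Kind → Subset → ℕ → Set
RowOf fin = FiniteRow
RowOf cof = CofiniteRow

fin≢cof : fin ≢ cof
fin≢cof ()

_≟ₖ_ : (k l : Kind) → Dec (k ≡ l)
fin ≟ₖ fin = yes refl
fin ≟ₖ cof = no fin≢cof
cof ≟ₖ fin = no λ ()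
cof ≟ₖ cof = yes refl

flip : Kind → Kind
flip fin = cof
flip cof = fin

_⊓_ : Kind → Kind → Kind
fin ⊓ _ = fin
cof ⊓ l = l

_⊔_ : Kind → Kind → Kind
fin ⊔ l = l
cof ⊔ _ = cof

row-∁ : ∀ k {U i} → RowOf k U i → RowOf (flip k) (∁ U) i
row-∁ fin {U} {i} = finite-⊆ {∁ (∁ U)} {U} λ j → trans (sym (not-involutive (U (i , j))))
row-∁ cof r = r

row-∁⁻ : ∀ k {U i} → RowOf k (∁ U) i → RowOf (flip k) U i
row-∁⁻ fin r = r
row-∁⁻ cof {U} {i} = finite-⊆ {U} {∁ (∁ U)} λ j → trans (not-involutive (U (i , j)))

row-∩ : ∀ k l {U V i} → RowOf k U i → RowOf l V i → RowOf (k ⊓ l) (U ∩ V) i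
row-∩ fin _ {U} {V} {i} r _ =
  finite-⊆ {U ∩ V} {U} (λ j → ∧-conicalˡ (U (i , j)) (V (i , j))) r
row-∩ cof fin {U} {V} {i} _ s =
  finite-⊆ {U ∩ V} {V} (λ j → ∧-conicalʳ (U (i , j)) (V (i , j))) s
row-∩ cof cof {U} {V} {i} r s =
  finite-∪ {∁ (U ∩ V)} {∁ U} {∁ V} (λ j → not-∧-split (U (i , j)) (V (i , j))) r s

row-∪ : ∀ k l {U V i} → RowOf k U i → RowOf l V i → RowOf (k ⊔ l) (U ∪ V) i
row-∪ fin fin {U} {V} {i} r s =
  finite-∪ {U ∪ V} {U} {V} (λ j → ∨-split (U (i , j)) (V (i , j))) r s
row-∪ fin cof {U} {V} {i} _ s =
  finite-⊆ {∁ (U ∪ V)} {∁ V} (λ j → not-∨ʳ (U (i , j)) (V (i , j))) s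
row-∪ cof _ {U} {V} {i} r _ =
  finite-⊆ {∁ (U ∪ V)} {∁ U} (λ j → not-∨ˡ (U (i , j)) (V (i , j))) r

-- If a ∙ b differs from c ∙ d then a differs from c or b from d; this locates
-- the exceptional rows of a combination of two sets.

differs : ∀ (_∙_ : Kind → Kind → Kind) {a b c d} →
          a ∙ b ≢ c ∙ d → a ≢ c ⊎ b ≢ d
differs _∙_ {a} {b} {c} {d} ne with a ≟ₖ c | b ≟ₖ d
... | no a≢c    | _         = inj₁ a≢c
... | yes _     | no b≢d    = inj₂ b≢d
... | yes refl  | yes refl  = ⊥-elim (ne refl)

record Tame (k : Kind) (U : Subset) : Set where
  field
    kindOf      : ℕ → Kind
    row         : ∀ i → RowOf (kindOf i) U i
    exceptions  : List ℕ
    exceptional : ∀ i → kindOf i ≢ k → i ∈ exceptions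

tame-combine : ∀ (_⊙_ : Kind → Kind → Kind) (_⋆_ : Subset → Subset → Subset) →
               (∀ k l {U V i} → RowOf k U i → RowOf l V i → RowOf (k ⊙ l) (U ⋆ V) i) →
               ∀ {k l U V} → Tame k U → Tame l V → Tame (k ⊙ l) (U ⋆ V)
tame-combine _⊙_ _⋆_ row-⋆ t s = record
  { kindOf      = λ i → T.kindOf i ⊙ S.kindOf i
  ; row         = λ i → row-⋆ (T.kindOf i) (S.kindOf i) (T.row i) (S.row i)
  ; exceptions  = T.exceptions ++ S.exceptions
  ; exceptional = λ i ne →
      [ (λ a → ∈-++⁺ˡ (T.exceptional i a)) , (λ b → ∈-++⁺ʳ T.exceptions (S.exceptional i b)) ]
      (differs _⊙_ ne)
  }
  where
  module T = Tame t
  module S = Tame s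

flip-injective : ∀ {k l} → flip k ≢ flip l → k ≢ l
flip-injective ne k≡l = ne (cong flip k≡l)

tame-∁ : ∀ {k U} → Tame k U → Tame (flip k) (∁ U)
tame-∁ t = record
  { kindOf      = λ i → flip (kindOf i)
  ; row         = λ i → row-∁ (kindOf i) (row i)
  ; exceptions  = exceptions
  ; exceptional = λ i ne → exceptional i (flip-injective {kindOf i} ne)
  }
  where open Tame t

tame-∁⁻ : ∀ {k U} → Tame k (∁ U) → Tame (flip k) U
tame-∁⁻ t = record
  { kindOf      = λ i → flip (kindOf i)
  ; row         = λ i → row-∁⁻ (kindOf i) (row i)
  ; exceptions  = exceptions
  ; exceptional = λ i ne → exceptional i (flip-injective {kindOf i} ne)
  }
  where open Tame t

distinguished⇒tame : ∀ {U} → Distinguished U → Tame cof U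
distinguished⇒tame {U} (I , finiteIn , cofiniteOut) = record
  { kindOf = kindOf ; row = row ; exceptions = I ; exceptional = exceptional }
  where
  kindOf : ℕ → Kind
  kindOf i with i ∈? I
  ... | yes _ = fin
  ... | no  _ = cof

  row : ∀ i → RowOf (kindOf i) U i
  row i with i ∈? I
  ... | yes i∈I = finiteIn i i∈I
  ... | no  i∉I = cofiniteOut i i∉I

  exceptional : ∀ i → kindOf i ≢ cof → i ∈ I
  exceptional i ne with i ∈? I
  ... | yes i∈I = i∈I
  ... | no  _   = ⊥-elim (ne refl)

-- Conversely a tame set of kind cof is distinguished: I consists of the
-- exceptional rows that are finite.

tame⇒distinguished : ∀ {U} → Tame cof U → Distinguished U
tame⇒distinguished {U} t = I , finiteIn , cofiniteOut
  where
  open Tame t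

  I : List ℕ
  I = filter (λ i → kindOf i ≟ₖ fin) exceptions

  finiteIn : ∀ i → i ∈ I → FiniteRow U i
  finiteIn i i∈I = subst (λ k → RowOf k U i) (proj₂ (∈-filter⁻ (λ i → kindOf i ≟ₖ fin) {xs = exceptions} i∈I)) (row i)

  cofiniteOut : ∀ i → i ∉ I → CofiniteRow U i
  cofiniteOut i i∉I with kindOf i in eq
  ... | cof = subst (λ k → RowOf k U i) eq (row i)
  ... | fin = ⊥-elim (i∉I (∈-filter⁺ (λ i → kindOf i ≟ₖ fin) (exceptional i λ e → fin≢cof (trans (sym eq) e)) eq))

distOrCodist⇒tame : ∀ {U} → DistOrCodist U → ∃ λ k → Tame k U
distOrCodist⇒tame (inj₁ d) = cof , distinguished⇒tame d
distOrCodist⇒tame (inj₂ d) = fin , tame-∁⁻ (distinguished⇒tame d)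

tame⇒distOrCodist : ∀ {k U} → Tame k U → DistOrCodist U
tame⇒distOrCodist {cof} t = inj₁ (tame⇒distinguished t)
tame⇒distOrCodist {fin} t = inj₂ (tame⇒distinguished (tame-∁ t))

tame-∅ : Tame fin ∅
tame-∅ = record
  { kindOf      = λ _ → fin
  ; row         = λ _ → [] , λ _ ()
  ; exceptions  = []
  ; exceptional = λ _ ne → ⊥-elim (ne refl)
  }

tame-full : Tame cof full
tame-full = record
  { kindOf      = λ _ → cof
  ; row         = λ _ → [] , λ _ ()
  ; exceptions  = []
  ; exceptional = λ _ ne → ⊥-elim (ne refl)
  }

theorem1 : IsBooleanSubalgebra DistOrCodist
theorem1 = record
  { has-∅    = tame⇒distOrCodist tame-∅
  ; has-full = tame⇒distOrCodist tame-full
  ; closed-∩ = closedUnder _⊓_ _∩_ row-∩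
  ; closed-∪ = closedUnder _⊔_ _∪_ row-∪
  ; closed-∁ = λ _ p → tame⇒distOrCodist (tame-∁ (proj₂ (distOrCodist⇒tame p)))
  }
  where
  closedUnder : ∀ (_⊙_ : Kind → Kind → Kind) (_⋆_ : Subset → Subset → Subset) →
                (∀ k l {U V i} → RowOf k U i → RowOf l V i → RowOf (k ⊙ l) (U ⋆ V) i) →
                ∀ U V → DistOrCodist U → DistOrCodist V → DistOrCodist (U ⋆ V)
  closedUnder _⊙_ _⋆_ row-⋆ U V p q =
    tame⇒distOrCodist (tame-combine _⊙_ _⋆_ row-⋆
                         (proj₂ (distOrCodist⇒tame p)) (proj₂ (distOrCodist⇒tame q)))
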